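{- Let $m,n \geq 2$. Then the poset $\mathbb{P} = m \oplus n$ is S\l upecki.
   Context: Posets are viewed as reflexive digraphs with arc relation $\leq$. For $n\geq1$, $n$ also denotes the $n$-element antichain (no comparabilities other than $x\le x$). The ordinal sum $\mathbb{P}\oplus\mathbb{Q}$ is the disjoint union of $\mathbb{P}$ and $\mathbb{Q}$ with additionally $p\leq q$ for all $p\in P$, $q\in Q$. A $k$-ary polymorphism of $\mathbb{P}$ is a monotone map $\mathbb{P}^k\to\mathbb{P}$ (product order); it is essentially unary if it equals $(x_1,\dots,x_k)\mapsto g(x_i)$ for some $i$ and some monotone $g:\mathbb{P}\to\mathbb{P}$. $\mathbb{P}$ is S\l upecki if for every $k\geq 2$ every surjective $k$-ary polymorphism is essentially unary. -}

module Defs where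

open import Level using (0ℓ)
open import Data.Nat using (ℕ) renaming (_≤_ to _≤ℕ_)
open import Data.Fin using (Fin)
open import Data.Sum using (_⊎_; inj₁; inj₂)
open import Data.Product using (Σ; ∃; _×_)
open import Data.Unit using (⊤)
open import Data.Empty using (⊥)
open import Relation.Binary.PropositionalEquality using (_≡_)

Rel : Set → Set₁
Rel A = A → A → Set

Antichain : (n : ℕ) → Rel (Fin n)
Antichain n x y = x ≡ y

_⊕_ : {A B : Set} → Rel A → Rel B → Rel (A ⊎ B)
(R ⊕ S) (inj₁ a) (inj₁ a') = R a a'
(R ⊕ S) (inj₁ a) (inj₂ b)  = ⊤
(R ⊕ S) (inj₂ b) (inj₁ a)  = ⊥
(R ⊕ S) (inj₂ b) (inj₂ b') = S b b'

Monotone : {A : Set} → Rel A → (A → A) → Set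
Monotone _≤_ g = ∀ x y → x ≤ y → g x ≤ g y

Polymorphism : {A : Set} → Rel A → (k : ℕ) → ((Fin k → A) → A) → Set
Polymorphism {A} _≤_ k f = ∀ (x y : Fin k → A) → (∀ i → x i ≤ y i) → f x ≤ f y

Surjective : {A : Set} {k : ℕ} → ((Fin k → A) → A) → Set
Surjective {A} {k} f = ∀ (p : A) → Σ (Fin k → A) (λ x → f x ≡ p)

EssentiallyUnary : {A : Set} → Rel A → (k : ℕ) → ((Fin k → A) → A) → Set
EssentiallyUnary {A} _≤_ k f =
  Σ (Fin k) (λ i → Σ (A → A) (λ g → Monotone _≤_ g × (∀ (x : Fin k → A) → f x ≡ g (x i))))

Slupecki : {A : Set} → Rel A → Set
Slupecki {A} _≤_ = ∀ (k : ℕ) → 2 ≤ℕ k → (f : (Fin k → A) → A) →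
  Polymorphism _≤_ k f → Surjective f → EssentiallyUnary _≤_ k f

-- A surjective polymorphism f of m ⊕ n maps the bottom layer Bᵏ onto B and the top layer Tᵏ
-- onto T.  As f is not constant on Tᵏ, it changes value between two top tuples w, w' differing
-- only at some coordinate j.  Then f on Bᵏ depends on coordinate j alone: writing x_j into
-- position j of w gives a tuple u above x and below w and w', so f u lies below two distinct
-- elements, hence is minimal, hence equals f x.  Dually f on Tᵏ depends on coordinate j alone.
-- Finally an arbitrary tuple z is squeezed the same way between its projection onto Bᵏ or Tᵏ
-- and two tuples of the other layer, which gives f z = f (z_j, …, z_j).
module Submission where

open import Defs
open import Data.Nat using (ℕ; _≤_; s≤s; suc)
open import Data.Fin using (Fin; zero; suc; _≟_)
open import Data.Sum using (_⊎_; inj₁; inj₂; [_,_]′)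
open import Data.Sum.Properties using (≡-dec; inj₁-injective; inj₂-injective)
open import Data.Product using (Σ; ∃-syntax; ∃₂; _,_; _×_)
open import Data.Unit using (tt)
open import Data.Vec.Functional using (Vector; _∷_; tail; updateAt)
open import Data.Vec.Functional.Properties using (updateAt-updates; updateAt-minimal)
open import Data.Vec.Functional.Relation.Binary.Pointwise using (Pointwise)
open import Function using (_∘_; id; const)
open import Relation.Nullary using (yes; no; contradiction)
open import Relation.Binary using (DecidableEquality)
open import Relation.Binary.PropositionalEquality

module _ {A : Set} {k : ℕ} where

  Extensional : {D : Set} → (Vector A k → D) → Set
  Extensional F = ∀ {u v} → (∀ i → u i ≡ v i) → F u ≡ F v

  AgreeOff : Fin k → Vector A k → Vector A k → Set
  AgreeOff j w w' = ∀ i → i ≢ j → w i ≡ w' i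

  SensitiveAt : {D : Set} → Fin k → (Vector A k → D) → Set
  SensitiveAt j F = Σ (Vector A k) λ w → Σ (Vector A k) λ w' → AgreeOff j w w' × F w ≢ F w'

  DependsOnlyOn : {D : Set} → Fin k → (Vector A k → D) → Set
  DependsOnlyOn j F = ∀ x x' → x j ≡ x' j → F x ≡ F x'

  updateAt-pointwise : (P : Fin k → A → Set) (v : Vector A k) {j : Fin k} {a : A} →
                       P j a → (∀ i → i ≢ j → P i (v i)) → ∀ i → P i (updateAt v j (const a) i)
  updateAt-pointwise P v {j} pj p-off i with i ≟ j
  ... | yes refl = subst (P j) (sym (updateAt-updates j v)) pj
  ... | no i≢j   = subst (P i) (sym (updateAt-minimal i j v i≢j)) (p-off i i≢j)

  dependsOnlyOn⇒sensitiveAt : ∀ {D : Set} {j} {F : Vector A k → D} →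
                              DependsOnlyOn j F → ∀ {y y'} → F y ≢ F y' → SensitiveAt j F
  dependsOnlyOn⇒sensitiveAt {j = j} {F} F-dep {y} {y'} Fy≢Fy' = y , y[j]≔y'ⱼ , agree , differ
    where
      y[j]≔y'ⱼ : Vector A k
      y[j]≔y'ⱼ = updateAt y j (const (y' j))

      agree : AgreeOff j y y[j]≔y'ⱼ
      agree i i≢j = sym (updateAt-minimal i j y i≢j)

      differ : F y ≢ F y[j]≔y'ⱼ
      differ e = Fy≢Fy' (trans e (F-dep y[j]≔y'ⱼ y' (updateAt-updates j y)))

sensitiveAt-suc : ∀ {A D : Set} {k} {F : Vector A (suc k) → D} {a j} →
                  SensitiveAt j (F ∘ (a ∷_)) → SensitiveAt (suc j) F
sensitiveAt-suc {a = a} (w , w' , agree , differ) = a ∷ w , a ∷ w' , agree-suc , differ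
  where
    agree-suc : AgreeOff _ (a ∷ w) (a ∷ w')
    agree-suc zero    _ = refl
    agree-suc (suc i) p = agree i (p ∘ cong suc)

-- Changing the coordinates of y into those of y' one at a time, some single step changes F.
nonconstant⇒sensitive : ∀ {A D : Set} {k} {F : Vector A k → D} → DecidableEquality D →
                        Extensional F → ∀ {y y'} → F y ≢ F y' → ∃[ j ] SensitiveAt j F
nonconstant⇒sensitive {k = 0} _ F-ext Fy≢Fy' = contradiction (F-ext λ ()) Fy≢Fy'
nonconstant⇒sensitive {k = suc k} {F} _≟D_ F-ext {y} {y'} Fy≢Fy'
  with F y ≟D F (y' zero ∷ tail y)
... | no differ = zero , y , y' zero ∷ tail y , agree , differ
  where
    agree : AgreeOff zero y (y' zero ∷ tail y)
    agree zero    0≢0 = contradiction refl 0≢0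
    agree (suc i) _   = refl
... | yes same
  with nonconstant⇒sensitive _≟D_ (λ h → F-ext λ { zero → refl ; (suc i) → h i }) tails-differ
  where
    tails-differ : F (y' zero ∷ tail y) ≢ F (y' zero ∷ tail y')
    tails-differ e = Fy≢Fy' (trans same (trans e (F-ext λ { zero → refl ; (suc i) → refl })))
...   | j , sensitive = suc j , sensitiveAt-suc sensitive

module _ {m n : ℕ} where

  private
    P : Set
    P = Fin m ⊎ Fin n

  infix 4 _≼_
  _≼_ : P → P → Set
  _≼_ = Antichain m ⊕ Antichain n

  ≼-refl : ∀ p → p ≼ p
  ≼-refl (inj₁ _) = refl
  ≼-refl (inj₂ _) = refl

  ≡⇒≼ : ∀ {p q} → p ≡ q → p ≼ q
  ≡⇒≼ {p} refl = ≼-refl p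

  ≼-antisym : ∀ {p q} → p ≼ q → q ≼ p → p ≡ q
  ≼-antisym {inj₁ _} {inj₁ _} a≡a' _ = cong inj₁ a≡a'
  ≼-antisym {inj₂ _} {inj₂ _} b≡b' _ = cong inj₂ b≡b'

  bottom-minimal : ∀ {p b} → p ≼ inj₁ b → p ≡ inj₁ b
  bottom-minimal {inj₁ _} a≡b = cong inj₁ a≡b

  top-maximal : ∀ {p t} → inj₂ t ≼ p → p ≡ inj₂ t
  top-maximal {inj₂ _} t≡s = cong inj₂ (sym t≡s)

  below-distinct⇒minimal : ∀ {p q q' r} → p ≼ q → p ≼ q' → q ≢ q' → r ≼ p → r ≡ p
  below-distinct⇒minimal {inj₁ _} _ _ _ r≼p = bottom-minimal r≼p
  below-distinct⇒minimal {inj₂ _} p≼q p≼q' q≢q' _ =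
    contradiction (trans (top-maximal p≼q) (sym (top-maximal p≼q'))) q≢q'

  above-distinct⇒maximal : ∀ {p q q' r} → q ≼ p → q' ≼ p → q ≢ q' → p ≼ r → r ≡ p
  above-distinct⇒maximal {inj₂ _} _ _ _ p≼r = top-maximal p≼r
  above-distinct⇒maximal {inj₁ _} q≼p q'≼p q≢q' _ =
    contradiction (trans (bottom-minimal q≼p) (sym (bottom-minimal q'≼p))) q≢q'

  toBottom : Fin m → P → Fin m
  toBottom d = [ id , const d ]′

  toTop : Fin n → P → Fin n
  toTop d = [ const d , id ]′

  toBottom-≼ : ∀ d p → inj₁ (toBottom d p) ≼ p
  toBottom-≼ d (inj₁ _) = refl
  toBottom-≼ d (inj₂ _) = tt

  ≼-toTop : ∀ d p → p ≼ inj₂ (toTop d p)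
  ≼-toTop d (inj₁ _) = tt
  ≼-toTop d (inj₂ _) = refl

  module PolymorphismProperties {k : ℕ} {f : Vector P k → P} (f-mono : Polymorphism _≼_ k f) where

    infix 4 _≼*_
    _≼*_ : Vector P k → Vector P k → Set
    _≼*_ = Pointwise _≼_

    ⇓_ : Vector (Fin m) k → Vector P k
    ⇓ x = inj₁ ∘ x

    ⇑_ : Vector (Fin n) k → Vector P k
    ⇑ y = inj₂ ∘ y

    f-ext : Extensional f
    f-ext {u} {v} u≗v = ≼-antisym (f-mono u v (≡⇒≼ ∘ u≗v)) (f-mono v u (≡⇒≼ ∘ sym ∘ u≗v))

    squeeze-below : ∀ u {v v' z} → u ≼* v → u ≼* v' → f v ≢ f v' → z ≼* u → f z ≡ f u
    squeeze-below _ u≼v u≼v' fv≢fv' z≼u =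
      below-distinct⇒minimal (f-mono _ _ u≼v) (f-mono _ _ u≼v') fv≢fv' (f-mono _ _ z≼u)

    squeeze-above : ∀ u {v v' z} → v ≼* u → v' ≼* u → f v ≢ f v' → u ≼* z → f z ≡ f u
    squeeze-above _ v≼u v'≼u fv≢fv' u≼z =
      above-distinct⇒maximal (f-mono _ _ v≼u) (f-mono _ _ v'≼u) fv≢fv' (f-mono _ _ u≼z)

    bottom-preimage : Surjective f → ∀ b → ∃[ x ] f (⇓ x) ≡ inj₁ b
    bottom-preimage f-surj b with f-surj (inj₁ b)
    ... | z , fz≡b =
      x , bottom-minimal (subst (f (⇓ x) ≼_) fz≡b (f-mono (⇓ x) z (toBottom-≼ b ∘ z)))
      where
        x : Vector (Fin m) k
        x = toBottom b ∘ z

    top-preimage : Surjective f → ∀ t → ∃[ y ] f (⇑ y) ≡ inj₂ t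
    top-preimage f-surj t with f-surj (inj₂ t)
    ... | z , fz≡t =
      y , top-maximal (subst (_≼ f (⇑ y)) fz≡t (f-mono z (⇑ y) (≼-toTop t ∘ z)))
      where
        y : Vector (Fin n) k
        y = toTop t ∘ z

    bottoms-nonconstant : Surjective f → ∀ {b b'} → b ≢ b' → ∃₂ λ x x' → f (⇓ x) ≢ f (⇓ x')
    bottoms-nonconstant f-surj {b} {b'} b≢b'
      with bottom-preimage f-surj b | bottom-preimage f-surj b'
    ... | x , fx≡b | x' , fx'≡b' =
      x , x' , λ e → b≢b' (inj₁-injective (trans (sym fx≡b) (trans e fx'≡b')))

    tops-nonconstant : Surjective f → ∀ {t t'} → t ≢ t' → ∃₂ λ y y' → f (⇑ y) ≢ f (⇑ y')
    tops-nonconstant f-surj {t} {t'} t≢t'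
      with top-preimage f-surj t | top-preimage f-surj t'
    ... | y , fy≡t | y' , fy'≡t' =
      y , y' , λ e → t≢t' (inj₂-injective (trans (sym fy≡t) (trans e fy'≡t')))

    bottoms-dependOnly : ∀ {j} → SensitiveAt j (f ∘ ⇑_) → DependsOnlyOn j (f ∘ ⇓_)
    bottoms-dependOnly {j} (w , w' , agree , differ) x x' xⱼ≡x'ⱼ =
      trans (squeeze-below u (u≼ w λ _ _ → refl) (u≼ w' agree) differ (≼u x refl))
            (sym (squeeze-below u (u≼ w λ _ _ → refl) (u≼ w' agree) differ (≼u x' xⱼ≡x'ⱼ)))
      where
        u : Vector P k
        u = updateAt (⇑ w) j (const (inj₁ (x j)))

        u≼ : ∀ w'' → AgreeOff j w w'' → u ≼* ⇑ w''
        u≼ w'' agree'' = updateAt-pointwise (λ i p → p ≼ inj₂ (w'' i)) (⇑ w) tt agree''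

        ≼u : ∀ x'' → x j ≡ x'' j → ⇓ x'' ≼* u
        ≼u x'' eq = updateAt-pointwise (λ i p → inj₁ (x'' i) ≼ p) (⇑ w) (sym eq) (λ _ _ → tt)

    tops-dependOnly : ∀ {j} → SensitiveAt j (f ∘ ⇓_) → DependsOnlyOn j (f ∘ ⇑_)
    tops-dependOnly {j} (x , x' , agree , differ) y y' yⱼ≡y'ⱼ =
      trans (squeeze-above u (≼u x λ _ _ → refl) (≼u x' agree) differ (u≼ y refl))
            (sym (squeeze-above u (≼u x λ _ _ → refl) (≼u x' agree) differ (u≼ y' yⱼ≡y'ⱼ)))
      where
        u : Vector P k
        u = updateAt (⇓ x) j (const (inj₂ (y j)))

        ≼u : ∀ x'' → AgreeOff j x x'' → ⇓ x'' ≼* u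
        ≼u x'' agree'' =
          updateAt-pointwise (λ i p → inj₁ (x'' i) ≼ p) (⇓ x) tt (λ i i≢j → sym (agree'' i i≢j))

        u≼ : ∀ y'' → y j ≡ y'' j → u ≼* ⇑ y''
        u≼ y'' eq = updateAt-pointwise (λ i p → p ≼ inj₂ (y'' i)) (⇓ x) eq (λ _ _ → tt)

    module _ {j} (bottoms-dep : DependsOnlyOn j (f ∘ ⇓_)) (tops-dep : DependsOnlyOn j (f ∘ ⇑_)) where

      bottom-coordinate : ∀ {y y'} → f (⇑ y) ≢ f (⇑ y') →
                          ∀ z {a} → z j ≡ inj₁ a → f z ≡ f (λ _ → inj₁ a)
      bottom-coordinate {y} {y'} differ z {a} zⱼ≡a = begin
        f z                 ≡⟨ squeeze-below z (z≼ y) (z≼ y') differ' (toBottom-≼ a ∘ z) ⟨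
        f (⇓ x)             ≡⟨ bottoms-dep x (λ _ → a) (cong (toBottom a) zⱼ≡a) ⟩
        f (λ _ → inj₁ a)    ∎
        where
          open ≡-Reasoning
          x : Vector (Fin m) k
          x = toBottom a ∘ z

          raise : Vector (Fin n) k → Vector P k
          raise y'' = ⇑ (toTop (y'' j) ∘ z)

          z≼ : ∀ y'' → z ≼* raise y''
          z≼ y'' = ≼-toTop (y'' j) ∘ z

          f-raise : ∀ y'' → f (raise y'') ≡ f (⇑ y'')
          f-raise y'' = tops-dep _ y'' (cong (toTop (y'' j)) zⱼ≡a)

          differ' : f (raise y) ≢ f (raise y')
          differ' e = differ (trans (sym (f-raise y)) (trans e (f-raise y')))

      top-coordinate : ∀ {x x'} → f (⇓ x) ≢ f (⇓ x') →
                       ∀ z {s} → z j ≡ inj₂ s → f z ≡ f (λ _ → inj₂ s)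
      top-coordinate {x} {x'} differ z {s} zⱼ≡s = begin
        f z                 ≡⟨ squeeze-above z (≼z x) (≼z x') differ' (≼-toTop s ∘ z) ⟨
        f (⇑ y)             ≡⟨ tops-dep y (λ _ → s) (cong (toTop s) zⱼ≡s) ⟩
        f (λ _ → inj₂ s)    ∎
        where
          open ≡-Reasoning
          y : Vector (Fin n) k
          y = toTop s ∘ z

          lower : Vector (Fin m) k → Vector P k
          lower x'' = ⇓ (toBottom (x'' j) ∘ z)

          ≼z : ∀ x'' → lower x'' ≼* z
          ≼z x'' = toBottom-≼ (x'' j) ∘ z

          f-lower : ∀ x'' → f (lower x'') ≡ f (⇓ x'')
          f-lower x'' = bottoms-dep _ x'' (cong (toBottom (x'' j)) zⱼ≡s)

          differ' : f (lower x) ≢ f (lower x')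
          differ' e = differ (trans (sym (f-lower x)) (trans e (f-lower x')))

      essentiallyUnary : ∀ {x x' y y'} → f (⇓ x) ≢ f (⇓ x') → f (⇑ y) ≢ f (⇑ y') →
                         EssentiallyUnary _≼_ k f
      essentiallyUnary bottoms-differ tops-differ = j , g , g-mono , f≡g∘proj
        where
          g : P → P
          g p = f (λ _ → p)

          g-mono : Monotone _≼_ g
          g-mono _ _ p≼q = f-mono _ _ (λ _ → p≼q)

          f≡g∘proj : ∀ z → f z ≡ g (z j)
          f≡g∘proj z with z j in zⱼ≡p
          ... | inj₁ _ = bottom-coordinate tops-differ z zⱼ≡p
          ... | inj₂ _ = top-coordinate bottoms-differ z zⱼ≡p

theorem5p1 : (m n : ℕ) → 2 ≤ m → 2 ≤ n → Slupecki (Antichain m ⊕ Antichain n)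
theorem5p1 (suc (suc m)) (suc (suc n)) (s≤s (s≤s _)) (s≤s (s≤s _)) k _ f f-mono f-surj =
  let open PolymorphismProperties {f = f} f-mono
      _ , _ , tops-differ    = tops-nonconstant f-surj 0≢1
      j , tops-sensitive     =
        nonconstant⇒sensitive (≡-dec _≟_ _≟_) (λ h → f-ext (cong inj₂ ∘ h)) tops-differ
      bottoms-dep            = bottoms-dependOnly tops-sensitive
      _ , _ , bottoms-differ = bottoms-nonconstant f-surj 0≢1
      tops-dep               = tops-dependOnly (dependsOnlyOn⇒sensitiveAt bottoms-dep bottoms-differ)
  in essentiallyUnary bottoms-dep tops-dep bottoms-differ tops-differ
  where
    0≢1 : ∀ {ℓ} → zero {suc ℓ} ≢ suc zero
    0≢1 ()
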